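{- Let $P_n$ be the path graph on $n\ge 4$ vertices. Then $\gamma_{0s}(P_n)=\lceil 3n/7\rceil$.
   Context: All graphs are finite, simple and undirected. For a graph $G=(V,E)$, a set $S\subseteq V$ is a dominating set if every vertex of $V\setminus S$ has a neighbor in $S$. A dominating set $S$ is an isolate dominating set (IDS) if the induced subgraph $G[S]$ has at least one isolated vertex. An IDS $S$ is an isolate secure dominating set (ISDS) if for each vertex $u\in V\setminus S$ there exists a neighbor $v$ of $u$ with $v\in S$ such that $(S\setminus\{v\})\cup\{u\}$ is an IDS of $G$. The isolate secure domination number $\gamma_{0s}(G)$ is the minimum cardinality of an ISDS of $G$. -}

module Defs where

open import Data.Nat using (ℕ; suc; _+_; _≤_)
open import Data.Fin using (Fin; toℕ)
open import Data.Fin.Subset using (Subset; _∈_; _∉_; ∣_∣; ⁅_⁆; _∪_; _-_)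
open import Data.Product using (Σ; ∃; ∃-syntax; _×_; _,_)
open import Relation.Binary.PropositionalEquality using (_≡_; _≢_)
open import Relation.Nullary using (¬_)
open import Data.Sum using (_⊎_)

record Graph (n : ℕ) : Set₁ where
  field
    Adj     : Fin n → Fin n → Set
    sym     : ∀ {u v} → Adj u v → Adj v u
    irrefl  : ∀ {u} → ¬ Adj u u

open Graph public

module _ {n : ℕ} (G : Graph n) where

  IsDominating : Subset n → Set
  IsDominating S = ∀ u → u ∉ S → ∃[ v ] (v ∈ S × Adj G u v)

  HasIsolatedIn : Subset n → Set
  HasIsolatedIn S = ∃[ v ] (v ∈ S × (∀ w → w ∈ S → ¬ Adj G v w))

  IsIDS : Subset n → Set
  IsIDS S = IsDominating S × HasIsolatedIn S

  IsISDS : Subset n → Set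
  IsISDS S = IsIDS S ×
    (∀ u → u ∉ S → ∃[ v ] (v ∈ S × Adj G u v × IsIDS ((S - v) ∪ ⁅ u ⁆)))

  IsolateSecureDominationNumber : ℕ → Set
  IsolateSecureDominationNumber k =
    (∃[ S ] (IsISDS S × ∣ S ∣ ≡ k)) × (∀ S → IsISDS S → k ≤ ∣ S ∣)

PathAdj : ∀ {n} → Fin n → Fin n → Set
PathAdj i j = (suc (toℕ i) ≡ toℕ j) ⊎ (suc (toℕ j) ≡ toℕ i)

open import Data.Sum using (inj₁; inj₂)
open import Data.Nat.Properties using (1+n≢n)

P : (n : ℕ) → Graph n
P n = record
  { Adj = PathAdj
  ; sym = λ { (inj₁ e) → inj₂ e ; (inj₂ e) → inj₁ e }
  ; irrefl = λ { {u} (inj₁ e) → 1+n≢n e ; {u} (inj₂ e) → 1+n≢n e }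
  }

-- Label each vertex of the path ● when it lies in S, and ▸ or ◂ when it lies outside S
-- and the neighbour it swaps with in the secure condition (its guard) is on its right or
-- left.  Swapping u with its guard v keeps the set dominating exactly when the vertex
-- beyond v is in S or is followed by a member of S, so secure dominating sets of Pₙ are
-- the words whose windows of four cells obey a local rule.
-- Lower bound: along an admissible word, Φ (last three cells) − 3·#vertices + 7·#members
-- never decreases (a finite check over the 4⁴ windows); the padded word starts and ends
-- with ○○○, hence 3n ≤ 7|S|.  Upper bound: a short head followed by copies of ▸●▸●◂●◂ is
-- admissible, has ⌈3n/7⌉ members, and contains two isolated members three apart, at
-- least one of which is not adjacent to the vertex entering in any swap.
module Submission where

open import Data.Bool using (Bool; true; false; T; not; _∧_; _∨_)
open import Data.Bool.ListAction using (all)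
open import Data.Bool.Properties using (T-∧; T-≡)
open import Data.Empty using (⊥-elim)
open import Data.Fin using (Fin; toℕ; zero; suc; inject₁; fromℕ<)
open import Data.Fin.Properties using (toℕ<n; toℕ-injective; _≟_; toℕ-inject₁; toℕ-fromℕ<)
open import Data.Fin.Subset using (Subset; inside; outside; ∣_∣; _∈_; _∉_; _-_; _∪_; ⁅_⁆)
open import Data.Fin.Subset.Properties
  using (_∈?_; x∈p∪q⁻; x∈p∪q⁺; p─q⊆p; x∈⁅y⁆⇒x≡y; x∈⁅x⁆; x∈p∧x≢y⇒x∈p-y)
open import Data.List using (List; []; _∷_; length; map)
open import Data.Nat using (ℕ; zero; suc; _+_; _*_; _/_; _%_; _≤_; _<_; _≤ᵇ_; z≤n; s≤s)
open import Data.Nat.DivMod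
  using (m≡m%n+[m/n]*n; m%n<n; /-congˡ; +-distrib-/-∣ʳ; m*n/n≡m; m<n*o⇒m/o<n)
open import Data.Nat.Divisibility using (divides-refl)
open import Data.Nat.ListAction using (sum)
open import Data.Nat.Properties
  using ( ≤ᵇ⇒≤; suc-injective; m≢1+n+m; _<?_; ≮⇒≥; n<1+n; n≤1+n; m≤n+m; 1+n≰n
        ; ≤-refl; ≤-trans; ≤-reflexive; ≤-pred; +-assoc; +-comm; +-mono-≤; +-monoˡ-≤; +-cancelˡ-≤
        ; module ≤-Reasoning)
  renaming (_≟_ to _≟ℕ_)
open import Data.Nat.Tactic.RingSolver using (solve-∀)
open import Data.Product using (_×_; _,_; proj₁; proj₂; ∃-syntax; Σ-syntax)
open import Data.Sum using (_⊎_; inj₁; inj₂; [_,_]′)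
import Data.Sum as Sum
open import Data.Unit using (tt)
open import Data.Vec using (_∷_; tabulate; lookup)
open import Data.Vec.Base using (there)
open import Data.Vec.Properties
  using (lookup∘tabulate; []=⇒lookup; lookup⇒[]=; tabulate∘lookup; tabulate-cong)
open import Function using (_∘_; id; flip; const; Equivalence)
open import Relation.Binary.PropositionalEquality
  using (_≡_; _≢_; refl; sym; trans; cong; cong₂; subst; module ≡-Reasoning)
open import Relation.Nullary using (¬_; Dec; yes; no)
open import Relation.Nullary.Decidable using (_⊎-dec_)

open import Defs hiding (sym)

-- ○ marks a position that is not a vertex of the path.
data Cell : Set where
  ○ ● ◂ ▸ : Cell

isIn : Cell → Bool
isIn ● = true
isIn _ = false

isOut : Cell → Bool
isOut ◂ = true
isOut ▸ = true
isOut _ = false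

-- For a guard v and the next two cells c d beyond it: once v leaves the set, c is still
-- dominated.
swapSafe : Cell → Cell → Bool
swapSafe c d = not (isOut c) ∨ isIn d

rightRule : Cell → Cell → Cell → Cell → Bool
rightRule ▸ b c d = isIn b ∧ swapSafe c d
rightRule _ _ _ _ = true

leftRule : Cell → Cell → Cell → Cell → Bool
leftRule a b c ◂ = isIn c ∧ swapSafe b a
leftRule _ _ _ _ = true

admissible : Cell → Cell → Cell → Cell → Bool
admissible a b c d = rightRule a b c d ∧ leftRule a b c d

linked : Cell → Cell → Bool
linked ▸ d = isIn d
linked _ _ = true

∧-elim : ∀ x y → T (x ∧ y) → T x × T y
∧-elim x y = Equivalence.to (T-∧ {x} {y})

∧-intro : ∀ {x y} → T x → T y → T (x ∧ y)
∧-intro p q = Equivalence.from T-∧ (p , q)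

rightRule⇒linked : ∀ a b c d → T (rightRule a b c d) → T (linked a b)
rightRule⇒linked ○ b c d _    = tt
rightRule⇒linked ● b c d _    = tt
rightRule⇒linked ◂ b c d _    = tt
rightRule⇒linked ▸ b c d rule = proj₁ (∧-elim (isIn b) _ rule)

Word : Set
Word = ℕ → Cell

infixr 5 _++ʷ_
_++ʷ_ : List Cell → Word → Word
([]       ++ʷ w) i       = w i
((c ∷ cs) ++ʷ w) zero    = c
((c ∷ cs) ++ʷ w) (suc i) = (cs ++ʷ w) i

-- Vertex i of the path sits at position 3 + i, so that the left rule of the first
-- vertices reads ○ for the missing neighbours.
pad : Word → Word
pad w = (○ ∷ ○ ∷ ○ ∷ []) ++ʷ w

windowAt : Word → ℕ → Bool
windowAt w i = admissible (w i) (w (1 + i)) (w (2 + i)) (w (3 + i))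

Guarded : Word → Set
Guarded w = ∀ i → T (windowAt w i)

pad-guarded : ∀ {w} →
              (∀ j → T (rightRule (w j) (w (1 + j)) (w (2 + j)) (w (3 + j)))) →
              (∀ i → T (leftRule (pad w i) (pad w (1 + i)) (pad w (2 + i)) (w i))) →
              Guarded (pad w)
pad-guarded right left 0                   = left 0
pad-guarded right left 1                   = left 1
pad-guarded right left 2                   = left 2
pad-guarded right left (suc (suc (suc j))) = ∧-intro (right j) (left (3 + j))

total : (Cell → ℕ) → Word → ℕ → ℕ
total f w zero    = 0
total f w (suc k) = f (w 0) + total f (w ∘ suc) k

present member : Cell → ℕ
present ○ = 0
present _ = 1
member ● = 1
member _ = 0

pending : Cell → Cell → ℕ
pending ▸ ● = 2
pending _ ● = 0
pending _ _ = 3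

-- Φ a b c − 3 bounds 3·#vertices − 7·#members over every admissible padded word read up
-- to the cells a b c.
Φ : Cell → Cell → Cell → ℕ
Φ ● ▸ ● = 1
Φ _ ▸ ● = 2
Φ _ _ ● = 0
Φ ▸ _ ◂ = 4
Φ _ _ ◂ = 3
Φ a b ▸ = 3 + pending a b
Φ a b ○ = pending a b

every : (Cell → Bool) → Bool
every p = p ○ ∧ p ● ∧ p ◂ ∧ p ▸

every-sound : ∀ p → T (every p) → ∀ c → T (p c)
every-sound p h ○ = proj₁ (∧-elim (p ○) _ h)
every-sound p h ● = proj₁ (∧-elim (p ●) _ (proj₂ (∧-elim (p ○) _ h)))
every-sound p h ◂ = proj₁ (∧-elim (p ◂) _ (proj₂ (∧-elim (p ●) _ (proj₂ (∧-elim (p ○) _ h)))))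
every-sound p h ▸ = proj₂ (∧-elim (p ◂) _ (proj₂ (∧-elim (p ●) _ (proj₂ (∧-elim (p ○) _ h)))))

modus-ponens : ∀ {x y} → T (not x ∨ y) → T x → T y
modus-ponens {true} h _ = h

transferᵇ : Cell → Cell → Cell → Cell → Bool
transferᵇ a b c d =
  not (admissible a b c d ∧ linked c d) ∨ (Φ a b c + 3 * present d ≤ᵇ Φ b c d + 7 * member d)

transferᵇ-holds : ∀ a b c d → T (transferᵇ a b c d)
transferᵇ-holds a b c d =
  every-sound (transferᵇ a b c)
    (every-sound (λ c → every (transferᵇ a b c))
      (every-sound (λ b → every λ c → every (transferᵇ a b c))
        (every-sound (λ a → every λ b → every λ c → every (transferᵇ a b c)) tt a) b) c) d

transfer : ∀ a b c d → T (admissible a b c d) → T (linked c d) →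
           Φ a b c + 3 * present d ≤ Φ b c d + 7 * member d
transfer a b c d adm lnk = ≤ᵇ⇒≤ _ _ (modus-ponens (transferᵇ-holds a b c d) (∧-intro adm lnk))

accumulate : ∀ a b e p P m M → a + 3 * p ≤ b + 7 * m → b + 3 * P ≤ e + 7 * M →
             a + 3 * (p + P) ≤ e + 7 * (m + M)
accumulate a b e p P m M first rest = begin
  a + 3 * (p + P)       ≡⟨ split a p P ⟩
  (a + 3 * p) + 3 * P   ≤⟨ +-mono-≤ first ≤-refl ⟩
  (b + 7 * m) + 3 * P   ≡⟨ swap b m P ⟩
  (b + 3 * P) + 7 * m   ≤⟨ +-mono-≤ rest ≤-refl ⟩
  (e + 7 * M) + 7 * m   ≡⟨ merge e M m ⟩
  e + 7 * (m + M)       ∎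
  where
  open ≤-Reasoning
  split : ∀ a p P → a + 3 * (p + P) ≡ (a + 3 * p) + 3 * P
  split = solve-∀
  swap : ∀ b m P → (b + 7 * m) + 3 * P ≡ (b + 3 * P) + 7 * m
  swap = solve-∀
  merge : ∀ e M m → (e + 7 * M) + 7 * m ≡ e + 7 * (m + M)
  merge = solve-∀

scan : ∀ w → Guarded w → ∀ k →
       Φ (w 0) (w 1) (w 2) + 3 * total present (w ∘ (3 +_)) k
         ≤ Φ (w k) (w (1 + k)) (w (2 + k)) + 7 * total member (w ∘ (3 +_)) k
scan w guarded zero    = ≤-refl
scan w guarded (suc k) =
  accumulate (Φ (w 0) (w 1) (w 2)) (Φ (w 1) (w 2) (w 3)) (Φ (w (suc k)) (w (2 + k)) (w (3 + k)))
    (present (w 3)) (total present (w ∘ (4 +_)) k) (member (w 3)) (total member (w ∘ (4 +_)) k)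
    (transfer (w 0) (w 1) (w 2) (w 3) (guarded 0) third-linked)
    (scan (w ∘ suc) (guarded ∘ suc) k)
  where
  third-linked : T (linked (w 2) (w 3))
  third-linked = rightRule⇒linked (w 2) (w 3) (w 4) (w 5)
                   (proj₁ (∧-elim (rightRule (w 2) (w 3) (w 4) (w 5)) _ (guarded 2)))

record Labelling (n : ℕ) (w : Word) : Set where
  field
    vertex  : ∀ {i} → i < n → w i ≢ ○
    beyond  : ∀ {i} → n ≤ i → w i ≡ ○
    guarded : Guarded (pad w)

membersOf : ∀ n → Word → Subset n
membersOf n w = tabulate (λ x → isIn (w (toℕ x)))

∣membersOf∣ : ∀ n w → ∣ membersOf n w ∣ ≡ total member w n
∣membersOf∣ zero    w = refl
∣membersOf∣ (suc n) w with w 0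
... | ○ = ∣membersOf∣ n (w ∘ suc)
... | ● = cong suc (∣membersOf∣ n (w ∘ suc))
... | ◂ = ∣membersOf∣ n (w ∘ suc)
... | ▸ = ∣membersOf∣ n (w ∘ suc)

total-present : ∀ n w → (∀ {i} → i < n → w i ≢ ○) → total present w n ≡ n
total-present zero    w vertex = refl
total-present (suc n) w vertex with w 0 in w0
... | ○ = ⊥-elim (vertex (s≤s z≤n) w0)
... | ● = cong suc (total-present n (w ∘ suc) (vertex ∘ s≤s))
... | ◂ = cong suc (total-present n (w ∘ suc) (vertex ∘ s≤s))
... | ▸ = cong suc (total-present n (w ∘ suc) (vertex ∘ s≤s))

total-beyond : ∀ f → f ○ ≡ 0 → ∀ n w → (∀ {i} → n ≤ i → w i ≡ ○) →
               ∀ k → total f w (n + k) ≡ total f w n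
total-beyond f f○ zero    w beyond zero    = refl
total-beyond f f○ zero    w beyond (suc k) =
  cong₂ _+_ (trans (cong f (beyond z≤n)) f○) (total-beyond f f○ zero (w ∘ suc) (λ _ → beyond z≤n) k)
total-beyond f f○ (suc n) w beyond k =
  cong (f (w 0) +_) (total-beyond f f○ n (w ∘ suc) (beyond ∘ s≤s) k)

labelling-bound : ∀ {n w} → Labelling n w → 3 * n ≤ 7 * total member w n
labelling-bound {n} {w} L = +-cancelˡ-≤ 3 _ _ (begin
  3 + 3 * n
    ≡⟨ cong (λ k → 3 + 3 * k) (sym vertices) ⟩
  Φ ○ ○ ○ + 3 * total present w (3 + n)
    ≤⟨ scan (pad w) guarded (3 + n) ⟩
  Φ (w n) (w (1 + n)) (w (2 + n)) + 7 * total member w (3 + n)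
    ≡⟨ cong₂ (λ a m → a + 7 * m) Φ-end members ⟩
  3 + 7 * total member w n
    ∎)
  where
  open Labelling L
  open ≤-Reasoning
  vertices : total present w (3 + n) ≡ n
  vertices = trans (cong (total present w) (+-comm 3 n))
               (trans (total-beyond present refl n w beyond 3) (total-present n w vertex))
  members : total member w (3 + n) ≡ total member w n
  members = trans (cong (total member w) (+-comm 3 n)) (total-beyond member refl n w beyond 3)
  Φ-end : Φ (w n) (w (1 + n)) (w (2 + n)) ≡ 3
  Φ-end rewrite beyond (≤-refl {n}) | beyond (n≤1+n n) | beyond (m≤n+m n 2) = refl

x∉p-x : ∀ {n} (p : Subset n) x → x ∉ p - x
x∉p-x (s ∷ p) zero    ()
x∉p-x (s ∷ p) (suc x) (there x∈p-x) = x∉p-x p x x∈p-x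

lookup-∉ : ∀ {n} {S : Subset n} {x} → x ∉ S → lookup S x ≡ outside
lookup-∉ {S = S} {x} x∉S with lookup S x in e
... | inside  = ⊥-elim (x∉S (lookup⇒[]= x S e))
... | outside = refl

module _ {n} {S : Subset n} {u v : Fin n} where

  ∈-swap⁻ : ∀ {t} → t ∈ (S - v) ∪ ⁅ u ⁆ → t ≡ u ⊎ (t ∈ S × t ≢ v)
  ∈-swap⁻ t∈ with x∈p∪q⁻ (S - v) ⁅ u ⁆ t∈
  ... | inj₁ t∈S-v = inj₂ (p─q⊆p S ⁅ v ⁆ t∈S-v , λ { refl → x∉p-x S v t∈S-v })
  ... | inj₂ t∈⁅u⁆ = inj₁ (x∈⁅y⁆⇒x≡y u t∈⁅u⁆)

  ∈-swap⁺ : ∀ {t} → t ∈ S → t ≢ v → t ∈ (S - v) ∪ ⁅ u ⁆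
  ∈-swap⁺ t∈S t≢v = x∈p∪q⁺ (inj₁ (x∈p∧x≢y⇒x∈p-y t∈S t≢v))

  u∈swap : u ∈ (S - v) ∪ ⁅ u ⁆
  u∈swap = x∈p∪q⁺ (inj₂ (x∈⁅x⁆ u))

  swap-isolated : ∀ {G : Graph n} {y} → y ∈ S → (∀ t → t ∈ S → ¬ Adj G y t) →
                  Adj G u v → ¬ Adj G y u → HasIsolatedIn G ((S - v) ∪ ⁅ u ⁆)
  swap-isolated {G} {y} y∈S isolated u~v y≁u = y , ∈-swap⁺ y∈S y≢v , no-neighbour
    where
    y≢v : y ≢ v
    y≢v refl = y≁u (Graph.sym G u~v)
    no-neighbour : ∀ t → t ∈ (S - v) ∪ ⁅ u ⁆ → ¬ Adj G y t
    no-neighbour t t∈ with ∈-swap⁻ t∈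
    ... | inj₁ refl      = y≁u
    ... | inj₂ (t∈S , _) = isolated t t∈S

Next : ∀ {n} → Fin n → Fin n → Set
Next x y = suc (toℕ x) ≡ toℕ y

record Orientation (n : ℕ) : Set₁ where
  field
    _⇢_         : Fin n → Fin n → Set
    adjacent    : ∀ {x y} → Adj (P n) x y → x ⇢ y ⊎ y ⇢ x
    toAdj       : ∀ {x y} → x ⇢ y → Adj (P n) x y
    pred-unique : ∀ {x y z} → x ⇢ z → y ⇢ z → x ≡ y
    no-2-cycle  : ∀ {x y} → x ⇢ y → ¬ y ⇢ x
    no-3-cycle  : ∀ {x y z} → x ⇢ y → y ⇢ z → ¬ z ⇢ x

rightward : ∀ {n} → Orientation n
rightward = record
  { _⇢_         = Next
  ; adjacent    = id
  ; toAdj       = inj₁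
  ; pred-unique = λ x⇢z y⇢z → toℕ-injective (suc-injective (trans x⇢z (sym y⇢z)))
  ; no-2-cycle  = λ {x} x⇢y y⇢x → m≢1+n+m (toℕ x) {1} (sym (trans (cong suc x⇢y) y⇢x))
  ; no-3-cycle  = λ {x} x⇢y y⇢z z⇢x →
      m≢1+n+m (toℕ x) {2} (sym (trans (cong (2 +_) x⇢y) (trans (cong suc y⇢z) z⇢x)))
  }

leftward : ∀ {n} → Orientation n
leftward = record
  { _⇢_         = flip Next
  ; adjacent    = Sum.swap
  ; toAdj       = inj₂
  ; pred-unique = λ x⇢z y⇢z → toℕ-injective (trans (sym x⇢z) y⇢z)
  ; no-2-cycle  = flip (Orientation.no-2-cycle rightward)
  ; no-3-cycle  = λ x⇢y y⇢z z⇢x → Orientation.no-3-cycle rightward z⇢x y⇢z x⇢y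
  }

module _ {n} (O : Orientation n) where
  open Orientation O

  Covered : Subset n → Fin n → Set
  Covered S v = ∀ b → v ⇢ b → b ∈ S ⊎ ∃[ c ] (b ⇢ c × c ∈ S)

  GuardedBy : Subset n → Fin n → Set
  GuardedBy S u = ∃[ v ] (u ⇢ v × v ∈ S × Covered S v)

  dominating⇒covered : ∀ {S u v} → u ∉ S → v ∈ S → u ⇢ v →
                       IsDominating (P n) ((S - v) ∪ ⁅ u ⁆) → Covered S v
  dominating⇒covered {S} {u} {v} u∉S v∈S u⇢v dominating b v⇢b with b ∈? S
  ... | yes b∈S = inj₁ b∈S
  ... | no  b∉S = inj₂ (rescuer (dominating b b∉S'))
    where
    b∉S' : b ∉ (S - v) ∪ ⁅ u ⁆
    b∉S' b∈S' with ∈-swap⁻ b∈S'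
    ... | inj₁ refl      = no-2-cycle u⇢v v⇢b
    ... | inj₂ (b∈S , _) = b∉S b∈S
    rescuer : ∃[ t ] (t ∈ (S - v) ∪ ⁅ u ⁆ × Adj (P n) b t) → ∃[ c ] (b ⇢ c × c ∈ S)
    rescuer (t , t∈S' , b~t) with adjacent b~t | ∈-swap⁻ t∈S'
    ... | inj₁ b⇢t | inj₁ refl      = ⊥-elim (no-3-cycle u⇢v v⇢b b⇢t)
    ... | inj₁ b⇢t | inj₂ (t∈S , _) = t , b⇢t , t∈S
    ... | inj₂ t⇢b | inj₁ refl      = ⊥-elim (u∉S (subst (_∈ S) (pred-unique v⇢b t⇢b) v∈S))
    ... | inj₂ t⇢b | inj₂ (_ , t≢v) = ⊥-elim (t≢v (pred-unique t⇢b v⇢b))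

  covered⇒dominating : ∀ {S u v} → IsDominating (P n) S → v ∈ S → u ⇢ v →
                       Covered S v → IsDominating (P n) ((S - v) ∪ ⁅ u ⁆)
  covered⇒dominating {S} {u} {v} dominating v∈S u⇢v covered z z∉S' with z ≟ v
  ... | yes refl = u , u∈swap , Graph.sym (P n) (toAdj u⇢v)
  ... | no  z≢v  = redirect (dominating z z∉S)
    where
    z∉S : z ∉ S
    z∉S z∈S = z∉S' (∈-swap⁺ z∈S z≢v)
    redirect : ∃[ t ] (t ∈ S × Adj (P n) z t) → ∃[ t ] (t ∈ (S - v) ∪ ⁅ u ⁆ × Adj (P n) z t)
    redirect (t , t∈S , z~t) with t ≟ v
    ... | no  t≢v  = t , ∈-swap⁺ t∈S t≢v , z~t
    ... | yes refl with adjacent z~t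
    ...   | inj₁ z⇢v = ⊥-elim (z∉S' (subst (_∈ (S - v) ∪ ⁅ u ⁆) (sym (pred-unique z⇢v u⇢v)) u∈swap))
    ...   | inj₂ v⇢z with covered z v⇢z
    ...     | inj₁ z∈S             = ⊥-elim (z∉S z∈S)
    ...     | inj₂ (c , z⇢c , c∈S) = c , ∈-swap⁺ c∈S (λ { refl → no-2-cycle v⇢z z⇢c }) , toAdj z⇢c

not-member : ∀ {c} → T (not (isIn c)) → c ≢ ●
not-member () refl

isIn⇒● : ∀ {c} → T (isIn c) → c ≡ ●
isIn⇒● {●} _ = refl

swapSafe-● : ∀ c → T (swapSafe c ●)
swapSafe-● ○ = tt
swapSafe-● ● = tt
swapSafe-● ◂ = tt
swapSafe-● ▸ = tt

swapSafe-out : ∀ {c d} → T (isOut c) → T (swapSafe c d) → d ≡ ●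
swapSafe-out {◂} _ safe = isIn⇒● safe
swapSafe-out {▸} _ safe = isIn⇒● safe

cell-cases : ∀ c → c ≡ ○ ⊎ c ≡ ● ⊎ T (isOut c)
cell-cases ○ = inj₁ refl
cell-cases ● = inj₂ (inj₁ refl)
cell-cases ◂ = inj₂ (inj₂ tt)
cell-cases ▸ = inj₂ (inj₂ tt)

position : ∀ {n} i → n ≤ i ⊎ Σ[ x ∈ Fin n ] toℕ x ≡ i
position {n} i with i <? n
... | yes i<n = inj₂ (fromℕ< i<n , toℕ-fromℕ< i<n)
... | no  i≮n = inj₁ (≮⇒≥ i≮n)

predecessor : ∀ {n} (x : Fin n) → toℕ x ≡ 0 ⊎ ∃[ y ] Next y x
predecessor zero    = inj₁ refl
predecessor (suc x) = inj₂ (inject₁ x , cong (1 +_) (toℕ-inject₁ x))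

module Cells {n} {w : Word} (vertex : ∀ {i} → i < n → w i ≢ ○) (beyond : ∀ {i} → n ≤ i → w i ≡ ○) where

  S : Subset n
  S = membersOf n w

  ∈⇒● : ∀ {x} → x ∈ S → w (toℕ x) ≡ ●
  ∈⇒● {x} x∈S = isIn⇒● (Equivalence.from T-≡ (trans (sym (lookup∘tabulate _ x)) ([]=⇒lookup x∈S)))

  ●⇒∈ : ∀ {x} → w (toℕ x) ≡ ● → x ∈ S
  ●⇒∈ {x} w≡● = lookup⇒[]= x S (trans (lookup∘tabulate _ x) (cong isIn w≡●))

  memberAt : ∀ {i} → w i ≡ ● → ∃[ x ] (toℕ x ≡ i × x ∈ S)
  memberAt {i} w≡● with position i
  ... | inj₂ (x , x≡) = x , x≡ , ●⇒∈ (trans (cong w x≡) w≡●)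
  ... | inj₁ n≤i with trans (sym w≡●) (beyond n≤i)
  ...   | ()

  next-member : ∀ x → w (suc (toℕ x)) ≡ ● → ∃[ y ] (Next x y × y ∈ S)
  next-member x w≡● with memberAt w≡●
  ... | y , y≡ , y∈S = y , sym y≡ , y∈S

  previous-member : ∀ x → pad w (2 + toℕ x) ≡ ● → ∃[ y ] (Next y x × y ∈ S)
  previous-member x pad≡● with predecessor x
  ... | inj₂ (y , y→x) = y , y→x , ●⇒∈ {y} (subst (λ i → pad w (2 + i) ≡ ●) (sym y→x) pad≡●)
  ... | inj₁ x≡0 with subst (λ i → pad w (2 + i) ≡ ●) x≡0 pad≡●
  ...   | ()

  covered⇒rightSafe : ∀ {v} → Covered rightward S v → T (swapSafe (w (1 + toℕ v)) (w (2 + toℕ v)))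
  covered⇒rightSafe {v} covered with position (suc (toℕ v))
  ... | inj₁ n≤i rewrite beyond n≤i = tt
  ... | inj₂ (b , b≡) = subst (λ i → T (swapSafe (w i) (w (suc i)))) b≡ (safe-at b (sym b≡))
    where
    safe-at : ∀ b → Next v b → T (swapSafe (w (toℕ b)) (w (suc (toℕ b))))
    safe-at b v→b with covered b v→b
    ... | inj₁ b∈S rewrite ∈⇒● b∈S = tt
    ... | inj₂ (c , b→c , c∈S) rewrite b→c | ∈⇒● c∈S = swapSafe-● _

  rightSafe⇒covered : ∀ {v} → T (swapSafe (w (1 + toℕ v)) (w (2 + toℕ v))) → Covered rightward S v
  rightSafe⇒covered {v} safe b v→b with cell-cases (w (toℕ b))
  ... | inj₁ w≡○        = ⊥-elim (vertex (toℕ<n b) w≡○)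
  ... | inj₂ (inj₁ w≡●) = inj₁ (●⇒∈ w≡●)
  ... | inj₂ (inj₂ out) = inj₂ (next-member b (swapSafe-out out safe′))
    where
    safe′ : T (swapSafe (w (toℕ b)) (w (suc (toℕ b))))
    safe′ = subst (λ i → T (swapSafe (w i) (w (suc i)))) v→b safe

  covered⇒leftSafe : ∀ {v} → Covered leftward S v → T (swapSafe (pad w (2 + toℕ v)) (pad w (1 + toℕ v)))
  covered⇒leftSafe {v} covered with predecessor v
  ... | inj₁ v≡0 rewrite v≡0 = tt
  ... | inj₂ (b , b→v) with covered b b→v
  ...   | inj₁ b∈S rewrite sym b→v | ∈⇒● b∈S = tt
  ...   | inj₂ (c , c→b , c∈S) rewrite sym b→v | sym c→b | ∈⇒● c∈S = swapSafe-● _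

  leftSafe⇒covered : ∀ {v} → T (swapSafe (pad w (2 + toℕ v)) (pad w (1 + toℕ v))) → Covered leftward S v
  leftSafe⇒covered {v} safe b b→v with cell-cases (w (toℕ b))
  ... | inj₁ w≡○        = ⊥-elim (vertex (toℕ<n b) w≡○)
  ... | inj₂ (inj₁ w≡●) = inj₁ (●⇒∈ w≡●)
  ... | inj₂ (inj₂ out) = inj₂ (previous-member b (swapSafe-out out safe′))
    where
    safe′ : T (swapSafe (w (toℕ b)) (pad w (2 + toℕ b)))
    safe′ = subst (λ i → T (swapSafe (pad w (2 + i)) (pad w (1 + i)))) (sym b→v) safe

  guarded⇒rightRule : ∀ {u} → GuardedBy rightward S u →
                      T (rightRule ▸ (w (1 + toℕ u)) (w (2 + toℕ u)) (w (3 + toℕ u)))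
  guarded⇒rightRule (v , u→v , v∈S , covered) rewrite u→v | ∈⇒● v∈S = covered⇒rightSafe covered

  rightRule⇒guarded : ∀ {u} → T (rightRule ▸ (w (1 + toℕ u)) (w (2 + toℕ u)) (w (3 + toℕ u))) →
                      GuardedBy rightward S u
  rightRule⇒guarded {u} rule with ∧-elim (isIn (w (1 + toℕ u))) _ rule
  ... | guard , safe with next-member u (isIn⇒● guard)
  ...   | v , u→v , v∈S =
    v , u→v , v∈S , rightSafe⇒covered (subst (λ i → T (swapSafe (w (suc i)) (w (2 + i)))) u→v safe)

  guarded⇒leftRule : ∀ {u} → GuardedBy leftward S u →
                     T (leftRule (pad w (toℕ u)) (pad w (1 + toℕ u)) (pad w (2 + toℕ u)) ◂)
  guarded⇒leftRule (v , v→u , v∈S , covered) rewrite sym v→u | ∈⇒● v∈S = covered⇒leftSafe covered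

  leftRule⇒guarded : ∀ {u} → T (leftRule (pad w (toℕ u)) (pad w (1 + toℕ u)) (pad w (2 + toℕ u)) ◂) →
                     GuardedBy leftward S u
  leftRule⇒guarded {u} rule with ∧-elim (isIn (pad w (2 + toℕ u))) _ rule
  ... | guard , safe with previous-member u (isIn⇒● guard)
  ...   | v , v→u , v∈S =
    v , v→u , v∈S , leftSafe⇒covered (subst (λ i → T (swapSafe (pad w (1 + i)) (pad w i))) (sym v→u) safe)

IsSecure : ∀ {n} → Graph n → Subset n → Set
IsSecure G S = ∀ u → u ∉ S → ∃[ v ] (v ∈ S × Adj G u v × IsDominating G ((S - v) ∪ ⁅ u ⁆))

IsISDS⇒IsSecure : ∀ {n} {G : Graph n} {S} → IsISDS G S → IsSecure G S
IsISDS⇒IsSecure (_ , secure) u u∉S with secure u u∉S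
... | v , v∈S , u~v , dominating , _ = v , v∈S , u~v , dominating

toWord : ∀ {n} → (Fin n → Cell) → Word
toWord {zero}  f i       = ○
toWord {suc n} f zero    = f zero
toWord {suc n} f (suc i) = toWord (f ∘ suc) i

toWord-toℕ : ∀ {n} (f : Fin n → Cell) x → toWord f (toℕ x) ≡ f x
toWord-toℕ f zero    = refl
toWord-toℕ f (suc x) = toWord-toℕ (f ∘ suc) x

toWord-beyond : ∀ {n} (f : Fin n → Cell) {i} → n ≤ i → toWord f i ≡ ○
toWord-beyond {zero}  f         _         = refl
toWord-beyond {suc n} f {suc i} (s≤s n≤i) = toWord-beyond (f ∘ suc) n≤i

toWord-vertex : ∀ {n} (f : Fin n → Cell) → (∀ x → f x ≢ ○) → ∀ {i} → i < n → toWord f i ≢ ○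
toWord-vertex {suc n} f f≢○ {zero}  _         = f≢○ zero
toWord-vertex {suc n} f f≢○ {suc i} (s≤s i<n) = toWord-vertex (f ∘ suc) (f≢○ ∘ suc) i<n

by-position : ∀ {n} (Q : ℕ → Set) → (∀ {i} → n ≤ i → Q i) → (∀ (x : Fin n) → Q (toℕ x)) → ∀ i → Q i
by-position Q beyond vertex i with position i
... | inj₁ n≤i      = beyond n≤i
... | inj₂ (x , x≡) = subst Q x≡ (vertex x)

module Secure {n} {S : Subset n} (secure : IsSecure (P n) S) where

  guard : ∀ u → u ∉ S → GuardedBy rightward S u ⊎ GuardedBy leftward S u
  guard u u∉S with secure u u∉S
  ... | v , v∈S , inj₁ u→v , dominating =
    inj₁ (v , u→v , v∈S , dominating⇒covered rightward u∉S v∈S u→v dominating)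
  ... | v , v∈S , inj₂ v→u , dominating =
    inj₂ (v , v→u , v∈S , dominating⇒covered leftward u∉S v∈S v→u dominating)

  classify : ∀ u → Dec (u ∈ S) → Cell
  classify u (yes _)   = ●
  classify u (no  u∉S) = [ const ▸ , const ◂ ]′ (guard u u∉S)

  role : Fin n → Cell
  role u = classify u (u ∈? S)

  role-vertex : ∀ u → role u ≢ ○
  role-vertex u with u ∈? S
  ... | yes _ = λ ()
  ... | no u∉S with guard u u∉S
  ...   | inj₁ _ = λ ()
  ...   | inj₂ _ = λ ()

  role-member : ∀ u → isIn (role u) ≡ lookup S u
  role-member u with u ∈? S
  ... | yes u∈S = sym ([]=⇒lookup u∈S)
  ... | no  u∉S with guard u u∉S
  ...   | inj₁ _ = sym (lookup-∉ u∉S)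
  ...   | inj₂ _ = sym (lookup-∉ u∉S)

  role-right : ∀ {u} → role u ≡ ▸ → GuardedBy rightward S u
  role-right {u} _ with u ∈? S
  ... | no u∉S with guard u u∉S
  ...   | inj₁ guarded = guarded

  role-left : ∀ {u} → role u ≡ ◂ → GuardedBy leftward S u
  role-left {u} _ with u ∈? S
  ... | no u∉S with guard u u∉S
  ...   | inj₂ guarded = guarded

  word : Word
  word = toWord role

  open Cells (toWord-vertex role role-vertex) (toWord-beyond role)
    using (guarded⇒rightRule; guarded⇒leftRule) renaming (S to members)

  S≡members : S ≡ members
  S≡members = trans (sym (tabulate∘lookup S))
                    (tabulate-cong λ x → trans (sym (role-member x)) (cong isIn (sym (toWord-toℕ role x))))

  rightRule-at : ∀ u → T (rightRule (word (toℕ u)) (word (1 + toℕ u)) (word (2 + toℕ u)) (word (3 + toℕ u)))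
  rightRule-at u rewrite toWord-toℕ role u with role u in eq
  ... | ○ = tt
  ... | ● = tt
  ... | ◂ = tt
  ... | ▸ = guarded⇒rightRule (subst (λ S → GuardedBy rightward S u) S≡members (role-right eq))

  leftRule-at : ∀ u →
    T (leftRule (pad word (toℕ u)) (pad word (1 + toℕ u)) (pad word (2 + toℕ u)) (word (toℕ u)))
  leftRule-at u rewrite toWord-toℕ role u with role u in eq
  ... | ○ = tt
  ... | ● = tt
  ... | ▸ = tt
  ... | ◂ = guarded⇒leftRule (subst (λ S → GuardedBy leftward S u) S≡members (role-left eq))

  labelling : Labelling n word
  labelling = record
    { vertex  = toWord-vertex role role-vertex
    ; beyond  = toWord-beyond role
    ; guarded = pad-guarded (by-position _ beyond-right rightRule-at) (by-position _ beyond-left leftRule-at)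
    }
    where
    beyond-right : ∀ {i} → n ≤ i → T (rightRule (word i) (word (1 + i)) (word (2 + i)) (word (3 + i)))
    beyond-right n≤i rewrite toWord-beyond role n≤i = tt
    beyond-left : ∀ {i} → n ≤ i → T (leftRule (pad word i) (pad word (1 + i)) (pad word (2 + i)) (word i))
    beyond-left n≤i rewrite toWord-beyond role n≤i = tt

secure-lower-bound : ∀ {n} {S : Subset n} → IsSecure (P n) S → 3 * n ≤ 7 * ∣ S ∣
secure-lower-bound {n} {S} secure =
  subst (λ k → 3 * n ≤ 7 * k) (sym (trans (cong ∣_∣ S≡members) (∣membersOf∣ n word)))
    (labelling-bound labelling)
  where open Secure secure

IsolatedAt : Word → ℕ → Set
IsolatedAt w y = T (not (isIn (pad w (2 + y))) ∧ isIn (pad w (3 + y)) ∧ not (isIn (pad w (4 + y))))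

adj-≤ : ∀ {n} {x y : Fin n} → Adj (P n) x y → toℕ x ≤ 1 + toℕ y
adj-≤ (inj₁ x→y) = ≤-trans (n≤1+n _) (≤-trans (≤-reflexive x→y) (n≤1+n _))
adj-≤ (inj₂ y→x) = ≤-reflexive (sym y→x)

far-apart : ∀ {n} {a b u : Fin n} → 3 + toℕ a ≤ toℕ b → Adj (P n) a u → ¬ Adj (P n) b u
far-apart a+3≤b a~u b~u = 1+n≰n (≤-trans a+3≤b (≤-trans (adj-≤ b~u) (s≤s (adj-≤ (Graph.sym (P _) a~u)))))

adjacent? : ∀ {n} (x y : Fin n) → Dec (Adj (P n) x y)
adjacent? x y = (suc (toℕ x) ≟ℕ toℕ y) ⊎-dec (suc (toℕ y) ≟ℕ toℕ x)

module FromLabelling {n w} (L : Labelling n w) where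
  open Labelling L
  open Cells vertex beyond

  rightRule-at : ∀ (u : Fin n) → w (toℕ u) ≡ ▸ →
                 T (rightRule ▸ (w (1 + toℕ u)) (w (2 + toℕ u)) (w (3 + toℕ u)))
  rightRule-at u eq = subst (λ c → T (rightRule c (w (1 + toℕ u)) (w (2 + toℕ u)) (w (3 + toℕ u)))) eq
                        (proj₁ (∧-elim (rightRule (w (toℕ u)) _ _ _) _ (guarded (3 + toℕ u))))

  leftRule-at : ∀ (u : Fin n) → w (toℕ u) ≡ ◂ →
                T (leftRule (pad w (toℕ u)) (pad w (1 + toℕ u)) (pad w (2 + toℕ u)) ◂)
  leftRule-at u eq = subst (λ c → T (leftRule (pad w (toℕ u)) (pad w (1 + toℕ u)) (pad w (2 + toℕ u)) c)) eq
                       (proj₂ (∧-elim (rightRule (pad w (toℕ u)) _ _ _) _ (guarded (toℕ u))))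

  guarded-by : ∀ u → u ∉ S → GuardedBy rightward S u ⊎ GuardedBy leftward S u
  guarded-by u u∉S with w (toℕ u) in eq
  ... | ○ = ⊥-elim (vertex (toℕ<n u) eq)
  ... | ● = ⊥-elim (u∉S (●⇒∈ eq))
  ... | ▸ = inj₁ (rightRule⇒guarded (rightRule-at u eq))
  ... | ◂ = inj₂ (leftRule⇒guarded (leftRule-at u eq))

  dominating : IsDominating (P n) S
  dominating u u∉S with guarded-by u u∉S
  ... | inj₁ (v , u→v , v∈S , _) = v , v∈S , inj₁ u→v
  ... | inj₂ (v , v→u , v∈S , _) = v , v∈S , inj₂ v→u

  isolated-member : ∀ {y} → IsolatedAt w y → ∃[ x ] (toℕ x ≡ y × x ∈ S × ∀ t → t ∈ S → ¬ Adj (P n) x t)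
  isolated-member {y} isolated with ∧-elim (not (isIn (pad w (2 + y)))) _ isolated
  ... | left-free , rest with ∧-elim (isIn (w y)) _ rest
  ...   | centre , right-free with memberAt (isIn⇒● centre)
  ...     | x , refl , x∈S = x , refl , x∈S , no-neighbour
    where
    no-neighbour : ∀ t → t ∈ S → ¬ Adj (P n) x t
    no-neighbour t t∈S (inj₁ x→t) =
      not-member (subst (λ i → T (not (isIn (w i)))) x→t right-free) (∈⇒● t∈S)
    no-neighbour t t∈S (inj₂ t→x) =
      not-member (subst (λ i → T (not (isIn (pad w (2 + i))))) (sym t→x) left-free) (∈⇒● t∈S)

  isds : ∀ {y₁ y₂} → 3 + y₁ ≤ y₂ → IsolatedAt w y₁ → IsolatedAt w y₂ → IsISDS (P n) S
  isds {y₁} {y₂} apart isolated₁ isolated₂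
    with isolated-member {y₁} isolated₁ | isolated-member {y₂} isolated₂
  ... | x₁ , refl , x₁∈S , lonely₁ | x₂ , refl , x₂∈S , lonely₂ =
    (dominating , x₁ , x₁∈S , lonely₁) , secure
    where
    stays-isolated : ∀ {u v} → Adj (P n) u v → HasIsolatedIn (P n) ((S - v) ∪ ⁅ u ⁆)
    stays-isolated {u} u~v with adjacent? x₁ u
    ... | no  x₁≁u = swap-isolated {G = P n} x₁∈S lonely₁ u~v x₁≁u
    ... | yes x₁~u = swap-isolated {G = P n} x₂∈S lonely₂ u~v (far-apart apart x₁~u)
    secure : ∀ u → u ∉ S → ∃[ v ] (v ∈ S × Adj (P n) u v × IsIDS (P n) ((S - v) ∪ ⁅ u ⁆))
    secure u u∉S with guarded-by u u∉S
    ... | inj₁ (v , u→v , v∈S , covered) =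
      v , v∈S , inj₁ u→v ,
      covered⇒dominating rightward dominating v∈S u→v covered , stays-isolated (inj₁ u→v)
    ... | inj₂ (v , v→u , v∈S , covered) =
      v , v∈S , inj₂ v→u ,
      covered⇒dominating leftward dominating v∈S v→u covered , stays-isolated (inj₂ v→u)

windowsOK : List Cell → Word → Bool
windowsOK []       q = true
windowsOK (c ∷ cs) q = windowAt ((c ∷ cs) ++ʷ q) 0 ∧ windowsOK cs q

guarded-++ʷ : ∀ cs q → T (windowsOK cs q) → Guarded q → Guarded (cs ++ʷ q)
guarded-++ʷ []       q _  guarded = guarded
guarded-++ʷ (c ∷ cs) q ok guarded zero    = proj₁ (∧-elim (windowAt ((c ∷ cs) ++ʷ q) 0) _ ok)
guarded-++ʷ (c ∷ cs) q ok guarded (suc i) =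
  guarded-++ʷ cs q (proj₂ (∧-elim (windowAt ((c ∷ cs) ++ʷ q) 0) _ ok)) guarded i

isVertex : Cell → Bool
isVertex ○ = false
isVertex _ = true

isVertex⇒≢○ : ∀ c → T (isVertex c) → c ≢ ○
isVertex⇒≢○ ○ () refl
isVertex⇒≢○ ● _ ()
isVertex⇒≢○ ◂ _ ()
isVertex⇒≢○ ▸ _ ()

++ʷ-vertex : ∀ cs {m q} → T (all isVertex cs) → (∀ {i} → i < m → q i ≢ ○) →
             ∀ {i} → i < length cs + m → (cs ++ʷ q) i ≢ ○
++ʷ-vertex []       _     q-vertex i<m = q-vertex i<m
++ʷ-vertex (c ∷ cs) cells q-vertex {zero}  _ = isVertex⇒≢○ c (proj₁ (∧-elim (isVertex c) _ cells))
++ʷ-vertex (c ∷ cs) cells q-vertex {suc i} (s≤s i<) =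
  ++ʷ-vertex cs (proj₂ (∧-elim (isVertex c) _ cells)) q-vertex i<

++ʷ-beyond : ∀ cs {m q} → (∀ {i} → m ≤ i → q i ≡ ○) → ∀ {i} → length cs + m ≤ i → (cs ++ʷ q) i ≡ ○
++ʷ-beyond []       q-beyond m≤i              = q-beyond m≤i
++ʷ-beyond (c ∷ cs) q-beyond {suc i} (s≤s ≤i) = ++ʷ-beyond cs q-beyond ≤i

total-++ʷ : ∀ f cs q m → total f (cs ++ʷ q) (length cs + m) ≡ sum (map f cs) + total f q m
total-++ʷ f []       q m = refl
total-++ʷ f (c ∷ cs) q m =
  trans (cong (f c +_) (total-++ʷ f cs q m)) (sym (+-assoc (f c) (sum (map f cs)) (total f q m)))

block : List Cell
block = ▸ ∷ ● ∷ ▸ ∷ ● ∷ ◂ ∷ ● ∷ ◂ ∷ []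

blocks : ℕ → Word
blocks zero    = λ _ → ○
blocks (suc k) = block ++ʷ blocks k

blocks-vertex : ∀ k {i} → i < k * 7 → blocks k i ≢ ○
blocks-vertex (suc k) = ++ʷ-vertex block tt (blocks-vertex k)

blocks-beyond : ∀ k {i} → k * 7 ≤ i → blocks k i ≡ ○
blocks-beyond zero    _ = refl
blocks-beyond (suc k)   = ++ʷ-beyond block (blocks-beyond k)

blocks-guarded : ∀ k → Guarded (blocks k)
blocks-guarded zero    _ = tt
blocks-guarded (suc k)   = guarded-++ʷ block (blocks k) (seam k) (blocks-guarded k)
  where
  seam : ∀ k → T (windowsOK block (blocks k))
  seam zero    = tt
  seam (suc k) = tt

blocks-members : ∀ k → total member (blocks k) (k * 7) ≡ k * 3
blocks-members zero    = refl
blocks-members (suc k) = trans (total-++ʷ member block (blocks k) (k * 7)) (cong (3 +_) (blocks-members k))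

HasISDSOfSize : ℕ → ℕ → Set
HasISDSOfSize n s = ∃[ S ] (IsISDS (P n) S × ∣ S ∣ ≡ s)

isds-from-head : ∀ (h : List Cell) k y₁ y₂ → T (all isVertex h) →
                 T (windowsOK (○ ∷ ○ ∷ ○ ∷ []) (h ++ʷ blocks k)) → T (windowsOK h (blocks k)) →
                 T (3 + y₁ ≤ᵇ y₂) → IsolatedAt (h ++ʷ blocks k) y₁ → IsolatedAt (h ++ʷ blocks k) y₂ →
                 HasISDSOfSize (length h + k * 7) (sum (map member h) + k * 3)
isds-from-head h k y₁ y₂ cells front inner apart isolated₁ isolated₂ =
  membersOf n w , FromLabelling.isds labelling (≤ᵇ⇒≤ (3 + y₁) y₂ apart) isolated₁ isolated₂ , size
  where
  n = length h + k * 7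
  w = h ++ʷ blocks k
  labelling : Labelling n w
  labelling = record
    { vertex  = ++ʷ-vertex h cells (blocks-vertex k)
    ; beyond  = ++ʷ-beyond h (blocks-beyond k)
    ; guarded = guarded-++ʷ (○ ∷ ○ ∷ ○ ∷ []) w front (guarded-++ʷ h (blocks k) inner (blocks-guarded k))
    }
  size : ∣ membersOf n w ∣ ≡ sum (map member h) + k * 3
  size = begin
    ∣ membersOf n w ∣                               ≡⟨ ∣membersOf∣ n w ⟩
    total member w n                                ≡⟨ total-++ʷ member h (blocks k) (k * 7) ⟩
    sum (map member h) + total member (blocks k) (k * 7)
                                                    ≡⟨ cong (sum (map member h) +_) (blocks-members k) ⟩
    sum (map member h) + k * 3                      ∎
    where open ≡-Reasoning

isds-by-residue : ∀ r k → r < 7 → 4 ≤ r + k * 7 → HasISDSOfSize (r + k * 7) ((3 * r + 6) / 7 + k * 3)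
isds-by-residue 0 (suc k) _ _ = isds-from-head [] (suc k) 1 5 tt tt tt tt tt tt
isds-by-residue 1 (suc k) _ _ = isds-from-head (● ∷ []) (suc k) 2 6 tt tt tt tt tt tt
isds-by-residue 2 (suc k) _ _ = isds-from-head (▸ ∷ ● ∷ []) (suc k) 3 7 tt tt tt tt tt tt
isds-by-residue 3 (suc k) _ _ = isds-from-head (▸ ∷ ● ∷ ● ∷ []) (suc k) 4 8 tt tt tt tt tt tt
isds-by-residue 4 zero    _ _ = isds-from-head (● ∷ ◂ ∷ ▸ ∷ ● ∷ []) zero 0 3 tt tt tt tt tt tt
isds-by-residue 4 (suc k) _ _ = isds-from-head (● ∷ ◂ ∷ ▸ ∷ ● ∷ []) (suc k) 0 3 tt tt tt tt tt tt
isds-by-residue 5 zero    _ _ = isds-from-head (● ∷ ◂ ∷ ● ∷ ◂ ∷ ● ∷ []) zero 0 4 tt tt tt tt tt tt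
isds-by-residue 5 (suc k) _ _ = isds-from-head (● ∷ ◂ ∷ ● ∷ ◂ ∷ ● ∷ []) (suc k) 0 4 tt tt tt tt tt tt
isds-by-residue 6 zero    _ _ = isds-from-head (▸ ∷ ● ∷ ▸ ∷ ● ∷ ◂ ∷ ● ∷ []) zero 1 5 tt tt tt tt tt tt
isds-by-residue 6 (suc k) _ _ = isds-from-head (▸ ∷ ● ∷ ▸ ∷ ● ∷ ◂ ∷ ● ∷ []) (suc k) 1 5 tt tt tt tt tt tt
isds-by-residue 1 zero    _ (s≤s ())
isds-by-residue 2 zero    _ (s≤s (s≤s ()))
isds-by-residue 3 zero    _ (s≤s (s≤s (s≤s ())))
isds-by-residue (suc (suc (suc (suc (suc (suc (suc _))))))) _
  (s≤s (s≤s (s≤s (s≤s (s≤s (s≤s (s≤s ()))))))) _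

ceil-shift : ∀ r k → (3 * (r + k * 7) + 6) / 7 ≡ (3 * r + 6) / 7 + k * 3
ceil-shift r k = begin
  (3 * (r + k * 7) + 6) / 7         ≡⟨ /-congˡ (regroup r k) ⟩
  ((3 * r + 6) + k * 3 * 7) / 7     ≡⟨ +-distrib-/-∣ʳ (3 * r + 6) (divides-refl (k * 3)) ⟩
  (3 * r + 6) / 7 + k * 3 * 7 / 7   ≡⟨ cong ((3 * r + 6) / 7 +_) (m*n/n≡m (k * 3) 7) ⟩
  (3 * r + 6) / 7 + k * 3           ∎
  where
  open ≡-Reasoning
  regroup : ∀ r k → 3 * (r + k * 7) + 6 ≡ (3 * r + 6) + k * 3 * 7
  regroup = solve-∀

ceil-bound : ∀ n s → 3 * n ≤ 7 * s → (3 * n + 6) / 7 ≤ s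
ceil-bound n s 3n≤7s = ≤-pred (m<n*o⇒m/o<n (begin-strict
  3 * n + 6   ≤⟨ +-monoˡ-≤ 6 3n≤7s ⟩
  7 * s + 6   ≡⟨ reorder s ⟩
  6 + s * 7   <⟨ n<1+n _ ⟩
  suc s * 7   ∎))
  where
  open ≤-Reasoning
  reorder : ∀ s → 7 * s + 6 ≡ 6 + s * 7
  reorder = solve-∀

isds-of-size : ∀ n → 4 ≤ n → HasISDSOfSize n ((3 * n + 6) / 7)
isds-of-size n 4≤n = subst (λ m → HasISDSOfSize m ((3 * m + 6) / 7)) (sym n≡) by-residue
  where
  n≡ : n ≡ n % 7 + n / 7 * 7
  n≡ = m≡m%n+[m/n]*n n 7
  by-residue : HasISDSOfSize (n % 7 + n / 7 * 7) ((3 * (n % 7 + n / 7 * 7) + 6) / 7)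
  by-residue = subst (HasISDSOfSize _) (sym (ceil-shift (n % 7) (n / 7)))
                 (isds-by-residue (n % 7) (n / 7) (m%n<n n 7) (subst (4 ≤_) n≡ 4≤n))

proposition2 : (n : ℕ) → 4 ≤ n →
    IsolateSecureDominationNumber (P n) ((3 * n + 6) / 7)
proposition2 n 4≤n =
  isds-of-size n 4≤n ,
  λ S isds → ceil-bound n ∣ S ∣ (secure-lower-bound (IsISDS⇒IsSecure {G = P n} isds))
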